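{- Let $\mathcal{A}$ be a contract automaton and let $\mathcal{K}$ be the most permissive controller of $\mathcal{A}$. Then $\mathscr{L}(\mathcal{K})=\mathfrak{A}\cap\mathscr{L}(\mathcal{A})$.
   Context: Fix disjoint sets $\mathbb{R}$ (requests) and $\mathbb{O}$ (offers $\overline a$) and an idle symbol $\Box$; $\Sigma=\mathbb{R}\cup\mathbb{O}\cup\{\Box\}$, $co$ swaps $a$ and $\overline a$ and fixes $\Box$. For $\vec v\in\Sigma^n$, $\vec v_{(i)}$ is its $i$-th entry, $\Box^k$ the vector of $k$ idle symbols. $\vec a\in\Sigma^n$ is a request (resp. offer) on $\alpha$ if $\vec a=\Box^{n_1}\alpha\Box^{n_2}$ with $\alpha\in\mathbb{R}$ (resp. $\mathbb{O}$), and a match on $\alpha$ if $\vec a=\Box^{n_1}\alpha\Box^{n_2}co(\alpha)\Box^{n_3}$. A contract automaton (CA) of rank $n$ is $\langle Q,\vec q_0,A^r,A^o,T,F\rangle$ with $Q=Q_1\times\cdots\times Q_n$ finite, $\vec q_0\in Q$, finite $A^r\subseteq\mathbb{R}$, $A^o\subseteq\mathbb{O}$, $F\subseteq Q$, $T\subseteq Q\times(A^r\cup A^o\cup\{\Box\})^n\times Q$ whose labels are requests, offers or matches and with $\vec a_{(i)}=\Box\Rightarrow\vec q_{(i)}=\vec q'_{(i)}$. $\mathscr{L}(\mathcal{A})$ is the set of words of labels along paths from $\vec q_0$ to a state in $F$. Observable: $Obs(\epsilon)=\epsilon$; $Obs(\vec a w)=\vec a_{(i)}Obs(w)$ if $\vec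 a$ is a request or offer with $\vec a_{(i)}\ne\Box$; $Obs(\vec aw)=\tau\,Obs(w)$ if $\vec a$ is a match. Agreement: $\mathfrak{A}=\{w\in(\Sigma^n)^*\mid n>1,\ Obs(w)\in(\mathbb{O}\cup\{\tau\})^*\}$. A CA $\mathcal{K}$ is a controller of $\mathcal{A}$ iff $\mathscr{L}(\mathcal{K})\subseteq\mathfrak{A}\cap\mathscr{L}(\mathcal{A})$; it is the most permissive controller if $\mathscr{L}(\mathcal{K}')\subseteq\mathscr{L}(\mathcal{K})$ for every controller $\mathcal{K}'$ of $\mathcal{A}$. -}

module Defs where

open import Data.Nat using (ℕ; _<_)
open import Data.Fin using (Fin; toℕ)
open import Data.Vec using (Vec; []; _∷_; lookup)
open import Data.List using (List)
open import Data.List.Membership.Propositional using (_∈_)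
open import Data.List.Relation.Unary.All using (All)
open import Data.List.Relation.Binary.Pointwise using (Pointwise)
open import Data.Bool using (Bool; true)
open import Data.Product using (Σ; _×_; _,_; ∃)
open import Data.Sum using (_⊎_)
open import Data.Unit using (⊤)
open import Relation.Binary.PropositionalEquality using (_≡_; _≢_)

-- Actions over a type N of action names: req a ∈ ℝ, off a = ā ∈ 𝕆, idle = □.
data Act (N : Set) : Set where
  req  : N → Act N
  off  : N → Act N
  idle : Act N

co : {N : Set} → Act N → Act N
co (req a) = off a
co (off a) = req a
co idle    = idle

module _ {N : Set} where

  Label : ℕ → Set
  Label n = Vec (Act N) n

  Word : ℕ → Set
  Word n = List (Label n)

  NonIdle : Act N → Set
  NonIdle α = α ≢ idle

  IsRequest : ∀ {n} → Label n → Set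
  IsRequest {n} a = Σ (Fin n) λ i → (∃ λ x → lookup a i ≡ req x)
                      × (∀ j → j ≢ i → lookup a j ≡ idle)

  IsOffer : ∀ {n} → Label n → Set
  IsOffer {n} a = Σ (Fin n) λ i → (∃ λ x → lookup a i ≡ off x)
                    × (∀ j → j ≢ i → lookup a j ≡ idle)

  IsMatch : ∀ {n} → Label n → Set
  IsMatch {n} a = Σ (Fin n) λ i → Σ (Fin n) λ j → toℕ i < toℕ j ×
                    (Σ (Act N) λ α → NonIdle α × lookup a i ≡ α × lookup a j ≡ co α
                       × (∀ k → k ≢ i → k ≢ j → lookup a k ≡ idle))

  data ObsSym : Set where
    act : Act N → ObsSym
    τ   : ObsSym

  -- Obs of a single label (Obs is only defined on requests/offers/matches)
  data ObsLetter {n : ℕ} (a : Label n) : ObsSym → Set where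
    obs-ro : IsRequest a ⊎ IsOffer a → (i : Fin n) → NonIdle (lookup a i) →
             ObsLetter a (act (lookup a i))
    obs-m  : IsMatch a → ObsLetter a τ

  Obs : ∀ {n} → Word n → List ObsSym → Set
  Obs w os = Pointwise ObsLetter w os

  OfferOrTau : ObsSym → Set
  OfferOrTau o = (∃ λ x → o ≡ act (off x)) ⊎ (o ≡ τ)

  Agreement : ∀ {n} → Word n → Set
  Agreement {n} w = (1 < n) × Σ (List ObsSym) λ os → Obs w os × All OfferOrTau os

  -- States of Q = Q_1 × ... × Q_n with Q_i = Fin (k_i)
  data St : ∀ {n} → Vec ℕ n → Set where
    []  : St []
    _∷_ : ∀ {m n} {ks : Vec ℕ n} → Fin m → St ks → St (m ∷ ks)

  comp : ∀ {n} {ks : Vec ℕ n} → St ks → Fin n → ℕ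
  comp (x ∷ q) Fin.zero    = toℕ x
  comp (x ∷ q) (Fin.suc i) = comp q i

  InAlph : List N → List N → Act N → Set
  InAlph Ar Ao (req x) = x ∈ Ar
  InAlph Ar Ao (off x) = x ∈ Ao
  InAlph Ar Ao idle    = ⊤

  record CA (n : ℕ) : Set where
    field
      k  : Vec ℕ n
      q0 : St k
      Ar : List N
      Ao : List N           -- A^o ⊆ 𝕆 (finite), names a of offers ā
      T  : List (St k × Label n × St k)
      F  : St k → Bool
      T-alph : ∀ {q a q'} → (q , a , q') ∈ T → ∀ i → InAlph Ar Ao (lookup a i)
      T-kind : ∀ {q a q'} → (q , a , q') ∈ T → IsRequest a ⊎ IsOffer a ⊎ IsMatch a
      T-idle : ∀ {q a q'} → (q , a , q') ∈ T → ∀ i → lookup a i ≡ idle →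
               comp q i ≡ comp q' i

  module _ {n : ℕ} (A : CA n) where
    open CA A
    data Run : St k → Word n → St k → Set where
      done : ∀ {q} → Run q List.[] q
      step : ∀ {q a q'' w q'} → (q , a , q'') ∈ T → Run q'' w q' → Run q (a List.∷ w) q'

    Lang : Word n → Set
    Lang w = Σ (St k) λ q → Run q0 w q × F q ≡ true

  Controller : ∀ {n} → CA n → CA n → Set
  Controller A K = ∀ w → Lang K w → Agreement w × Lang A w

  MostPermissive : ∀ {n} → CA n → CA n → Set
  MostPermissive A K = Controller A K × (∀ K' → Controller A K' → ∀ w → Lang K' w → Lang K w)

-- The inclusion ⊆ is the controller property.  For ⊇, take w ∈ 𝔄 ∩ 𝓛(A) and
-- build a contract automaton K_w over A's alphabets whose only accepted word
-- is w: a path of |w| + 1 states reading w.  Then K_w is a controller of A, so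
-- its language is contained in that of the most permissive controller.
-- The path must respect the CA condition that idle components do not move;
-- so the state after the prefix u of w records, for each component i, how many
-- labels of u have i as their first non-idle entry.  The components of that
-- state sum to |u|, which makes the states along the path pairwise distinct.
module Submission where

open import Defs
open import Data.Bool using (true)
open import Data.Bool.Properties using (T-≡)
open import Data.Fin using (Fin; zero; suc; toℕ; fromℕ<)
open import Data.Fin.Properties using (toℕ-fromℕ<; toℕ<n; toℕ≤n)
open import Data.List using (List; []; _∷_; _++_; _∷ʳ_; [_]; length; take; drop; tabulate)
open import Data.List.Membership.Propositional using (_∈_)
open import Data.List.Membership.Propositional.Properties using (∈-tabulate⁺; ∈-tabulate⁻)
open import Data.List.Properties using (∷-injectiveʳ; length-take; take-suc; drop-all)
open import Data.List.Relation.Unary.All using (All; []; _∷_)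
open import Data.List.Relation.Unary.All.Properties using (take⁺)
open import Data.Nat using (ℕ; zero; suc; _+_; _⊓_; _≤_; _≡ᵇ_; z≤n; s≤s)
open import Data.Nat.Properties
open import Data.Product using (∃; ∃₂; _×_; _,_; proj₁; proj₂)
open import Data.Product.Properties using (,-injectiveˡ; ,-injectiveʳ)
open import Data.Sum using (_⊎_; inj₁; inj₂)
open import Data.Vec using (Vec; _∷_; lookup; replicate)
open import Function using (case_of_)
open import Function.Bundles using (Equivalence)
open import Relation.Nullary using (contradiction)
open import Relation.Binary.PropositionalEquality using (_≡_; refl; sym; trans; cong; cong₂; module ≡-Reasoning)
open ≡-Reasoning

open import Algebra.Properties.CommutativeMonoid.Sum +-0-commutativeMonoid
  using (sum; ∑-distrib-+; sum-replicate-zero)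

drop-lookup : ∀ {A : Set} (xs : List A) (j : Fin (length xs)) →
              drop (toℕ j) xs ≡ Data.List.lookup xs j ∷ drop (suc (toℕ j)) xs
drop-lookup (x ∷ xs) zero    = refl
drop-lookup (x ∷ xs) (suc j) = drop-lookup xs j

drop≡∷⇒lookup : ∀ {A : Set} (t : ℕ) (xs : List A) {x r} → drop t xs ≡ x ∷ r →
                ∃ λ (j : Fin (length xs)) → toℕ j ≡ t × Data.List.lookup xs j ≡ x
drop≡∷⇒lookup zero    (x ∷ xs) refl = zero , refl , refl
drop≡∷⇒lookup (suc t) (x ∷ xs) eq with drop≡∷⇒lookup t xs eq
... | j , refl , x≡ = suc j , refl , x≡

module _ {N : Set} where

  Active : ∀ {m} → Vec (Act N) m → Set
  Active {m} a = ∃ λ (i : Fin m) → NonIdle (lookup a i)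

  leads : ∀ {m} → Vec (Act N) m → Fin m → ℕ
  leads (idle  ∷ a) zero    = 0
  leads (idle  ∷ a) (suc i) = leads a i
  leads (req _ ∷ a) zero    = 1
  leads (req _ ∷ a) (suc i) = 0
  leads (off _ ∷ a) zero    = 1
  leads (off _ ∷ a) (suc i) = 0

  leads-idle : ∀ {m} (a : Vec (Act N) m) i → lookup a i ≡ idle → leads a i ≡ 0
  leads-idle (idle  ∷ a) zero    _  = refl
  leads-idle (idle  ∷ a) (suc i) eq = leads-idle a i eq
  leads-idle (req _ ∷ a) (suc i) _  = refl
  leads-idle (off _ ∷ a) (suc i) _  = refl

  leads≤1 : ∀ {m} (a : Vec (Act N) m) i → leads a i ≤ 1
  leads≤1 (idle  ∷ a) zero    = z≤n
  leads≤1 (idle  ∷ a) (suc i) = leads≤1 a i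
  leads≤1 (req _ ∷ a) zero    = ≤-refl
  leads≤1 (req _ ∷ a) (suc i) = z≤n
  leads≤1 (off _ ∷ a) zero    = ≤-refl
  leads≤1 (off _ ∷ a) (suc i) = z≤n

  sum-leads : ∀ {m} (a : Vec (Act N) m) → Active a → sum (leads a) ≡ 1
  sum-leads (idle  ∷ a) (zero  , ni) = contradiction refl ni
  sum-leads (idle  ∷ a) (suc i , ni) = sum-leads a (i , ni)
  sum-leads {suc m} (req _ ∷ a) _    = cong suc (sum-replicate-zero m)
  sum-leads {suc m} (off _ ∷ a) _    = cong suc (sum-replicate-zero m)

  tally : ∀ {m} → List (Vec (Act N) m) → Fin m → ℕ
  tally []      i = 0
  tally (a ∷ u) i = leads a i + tally u i

  tally-++ : ∀ {m} (u v : List (Vec (Act N) m)) i → tally (u ++ v) i ≡ tally u i + tally v i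
  tally-++ []      v i = refl
  tally-++ (a ∷ u) v i = trans (cong (leads a i +_) (tally-++ u v i)) (sym (+-assoc (leads a i) _ _))

  tally-∷ʳ-idle : ∀ {m} (u : List (Vec (Act N) m)) a i → lookup a i ≡ idle →
                  tally (u ∷ʳ a) i ≡ tally u i
  tally-∷ʳ-idle u a i idle≡ = begin
    tally (u ∷ʳ a) i              ≡⟨ tally-++ u [ a ] i ⟩
    tally u i + (leads a i + 0)   ≡⟨ cong (λ x → tally u i + (x + 0)) (leads-idle a i idle≡) ⟩
    tally u i + 0                 ≡⟨ +-identityʳ _ ⟩
    tally u i                     ∎

  tally≤length : ∀ {m} (u : List (Vec (Act N) m)) i → tally u i ≤ length u
  tally≤length []      i = z≤n
  tally≤length (a ∷ u) i = +-mono-≤ (leads≤1 a i) (tally≤length u i)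

  sum-tally : ∀ {m} (u : List (Vec (Act N) m)) → All Active u → sum (tally u) ≡ length u
  sum-tally {m} []      []              = sum-replicate-zero m
  sum-tally (a ∷ u) (a-act ∷ u-act) = begin
    sum (tally (a ∷ u))              ≡⟨ ∑-distrib-+ (leads a) (tally u) ⟩
    sum (leads a) + sum (tally u)    ≡⟨ cong₂ _+_ (sum-leads a a-act) (sum-tally u u-act) ⟩
    suc (length u)                   ∎

  encode : ∀ {m b} (c : Fin m → ℕ) → (∀ i → c i ≤ b) → St {N} (replicate m (suc b))
  encode {zero}  c c≤b = []
  encode {suc m} c c≤b = fromℕ< (s≤s (c≤b zero)) ∷ encode (λ i → c (suc i)) (λ i → c≤b (suc i))

  comp-encode : ∀ {m b} (c : Fin m → ℕ) (c≤b : ∀ i → c i ≤ b) i → comp (encode c c≤b) i ≡ c i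
  comp-encode c c≤b zero    = toℕ-fromℕ< _
  comp-encode c c≤b (suc i) = comp-encode (λ j → c (suc j)) (λ j → c≤b (suc j)) i

  weight : ∀ {m} {ks : Vec ℕ m} → St {N} ks → ℕ
  weight []      = 0
  weight (x ∷ q) = toℕ x + weight q

  weight-encode : ∀ {m b} (c : Fin m → ℕ) (c≤b : ∀ i → c i ≤ b) → weight (encode c c≤b) ≡ sum c
  weight-encode {zero}  c c≤b = refl
  weight-encode {suc m} c c≤b =
    cong₂ _+_ (toℕ-fromℕ< _) (weight-encode (λ i → c (suc i)) (λ i → c≤b (suc i)))

  kind⇒Active : ∀ {n} {a : Label {N} n} → IsRequest a ⊎ IsOffer a ⊎ IsMatch a → Active a
  kind⇒Active (inj₁ (i , (_ , a≡) , _)) =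
    i , λ idle≡ → case trans (sym a≡) idle≡ of λ ()
  kind⇒Active (inj₂ (inj₁ (i , (_ , a≡) , _))) =
    i , λ idle≡ → case trans (sym a≡) idle≡ of λ ()
  kind⇒Active (inj₂ (inj₂ (i , _ , _ , _ , α≢idle , a≡ , _))) =
    i , λ idle≡ → α≢idle (trans (sym a≡) idle≡)

  module _ {n} (A : CA {N} n) where
    open CA A

    Run⇒All-Active : ∀ {q w q'} → Run A q w q' → All Active w
    Run⇒All-Active done               = []
    Run⇒All-Active (step {a = a} t r) = kind⇒Active {a = a} (T-kind t) ∷ Run⇒All-Active r

    Run⇒transition : ∀ {q w q'} → Run A q w q' → (j : Fin (length w)) →
                     ∃₂ λ p p' → (p , Data.List.lookup w j , p') ∈ T
    Run⇒transition (step t r) zero    = _ , _ , t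
    Run⇒transition (step t r) (suc j) = Run⇒transition r j

  module SingleWord {n} (A : CA {N} n) {w : Word {N} n} (w∈A : Lang A w) where
    open CA A using (Ar; Ao; T-alph; T-kind)

    L : ℕ
    L = length w

    Q : Set
    Q = St {N} (replicate n (suc L))

    tally-take≤L : ∀ t i → tally (take t w) i ≤ L
    tally-take≤L t i = ≤-trans (tally≤length (take t w) i)
                               (≤-trans (≤-reflexive (length-take t w)) (m⊓n≤n t L))

    state : ℕ → Q
    state t = encode (tally (take t w)) (tally-take≤L t)

    weight-state : ∀ {t} → t ≤ L → weight (state t) ≡ t
    weight-state {t} t≤L = begin
      weight (state t)          ≡⟨ weight-encode _ (tally-take≤L t) ⟩
      sum (tally (take t w))    ≡⟨ sum-tally (take t w) (take⁺ t (Run⇒All-Active A (proj₁ (proj₂ w∈A)))) ⟩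
      length (take t w)         ≡⟨ length-take t w ⟩
      t ⊓ L                    ≡⟨ m≤n⇒m⊓n≡m t≤L ⟩
      t                         ∎

    state-injective : ∀ {t u} → t ≤ L → u ≤ L → state t ≡ state u → t ≡ u
    state-injective {t} {u} t≤L u≤L eq =
      trans (sym (weight-state t≤L)) (trans (cong weight eq) (weight-state u≤L))

    edge : Fin L → Q × Label {N} n × Q
    edge j = state (toℕ j) , Data.List.lookup w j , state (suc (toℕ j))

    edge-idle : ∀ j i → lookup (Data.List.lookup w j) i ≡ idle →
                comp (state (toℕ j)) i ≡ comp (state (suc (toℕ j))) i
    edge-idle j i idle≡ = begin
      comp (state (toℕ j)) i                              ≡⟨ comp-encode _ (tally-take≤L (toℕ j)) i ⟩
      tally (take (toℕ j) w) i                            ≡⟨ tally-∷ʳ-idle (take (toℕ j) w) _ i idle≡ ⟨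
      tally (take (toℕ j) w ∷ʳ Data.List.lookup w j) i    ≡⟨ cong (λ u → tally u i) (take-suc w j) ⟨
      tally (take (suc (toℕ j)) w) i                      ≡⟨ comp-encode _ (tally-take≤L (suc (toℕ j))) i ⟨
      comp (state (suc (toℕ j))) i                        ∎

    edge-of-A : ∀ {e} → e ∈ tabulate edge → ∃₂ λ p p' → (p , proj₁ (proj₂ e) , p') ∈ CA.T A
    edge-of-A e∈ with ∈-tabulate⁻ e∈
    ... | j , refl = Run⇒transition A (proj₁ (proj₂ w∈A)) j

    K : CA {N} n
    K = record
      { k      = replicate n (suc L)
      ; q0     = state 0
      ; Ar     = Ar
      ; Ao     = Ao
      ; T      = tabulate edge
      ; F      = λ s → weight s ≡ᵇ L
      ; T-alph = λ e∈ → T-alph (proj₂ (proj₂ (edge-of-A e∈)))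
      ; T-kind = λ e∈ → T-kind (proj₂ (proj₂ (edge-of-A e∈)))
      ; T-idle = λ e∈ → case ∈-tabulate⁻ e∈ of λ { (j , refl) → edge-idle j }
      }

    final⇒weight≡L : ∀ s → CA.F K s ≡ true → weight s ≡ L
    final⇒weight≡L s f = ≡ᵇ⇒≡ (weight s) L (Equivalence.from T-≡ f)

    reads-only-suffix : ∀ {t v s} → t ≤ L → Run K (state t) v s → CA.F K s ≡ true → v ≡ drop t w
    reads-only-suffix {t} t≤L done f =
      sym (drop-all t w (≤-reflexive (trans (sym (final⇒weight≡L (state t) f)) (weight-state t≤L))))
    reads-only-suffix t≤L (step e∈ r) f with ∈-tabulate⁻ e∈
    ... | j , eq with state-injective t≤L (toℕ≤n j) (,-injectiveˡ eq) | ,-injectiveʳ eq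
    ... | refl | refl = trans (cong (_ ∷_) (reads-only-suffix (toℕ<n j) r f)) (sym (drop-lookup w j))

    reads-suffix : ∀ t v → drop t w ≡ v → Run K (state t) v (state (t + length v))
    reads-suffix t []      _  rewrite +-identityʳ t = done
    reads-suffix t (a ∷ v) eq rewrite +-suc t (length v)
      with drop≡∷⇒lookup t w eq
    ... | j , refl , refl =
      step (∈-tabulate⁺ j) (reads-suffix (suc (toℕ j)) v (∷-injectiveʳ (trans (sym (drop-lookup w j)) eq)))

    accepts-w : Lang K w
    accepts-w = state L , reads-suffix 0 w refl ,
                Equivalence.to T-≡ (≡⇒≡ᵇ _ L (weight-state ≤-refl))

    accepts-only-w : ∀ {v} → Lang K v → v ≡ w
    accepts-only-w (s , r , f) = reads-only-suffix z≤n r f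

    controller : Agreement w → Controller A K
    controller agree v v∈K rewrite accepts-only-w v∈K = agree , w∈A

proposition3p7 : {N : Set} (n : ℕ) (A K : CA {N} n) → MostPermissive A K →
                   ∀ w → (Lang K w → Agreement w × Lang A w) × (Agreement w × Lang A w → Lang K w)
proposition3p7 n A K (controller , maximal) w = controller w , λ (agree , w∈A) →
  let open SingleWord A w∈A renaming (K to Kw; controller to Kw-controller)
  in maximal Kw (Kw-controller agree) w accepts-w
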